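{- Let $k\in\mathbb N$. Every graph containing a $k$-independent-set-matching structure has a $k$-edge induced subgraph.
   Context: Graphs are simple, finite, with nonempty vertex set. A $k$-edge induced subgraph of $G$ is $G[S]$ for some nonempty $S\subseteq V(G)$ with exactly $k$ edges. $G=(V,E)$ contains a $k$-independent-set-matching structure on $2k$ vertices $u_1,\dots,u_k,v_1,\dots,v_k$ if (IM1) for all $i,j\in[k]$, $\{u_i,v_j\}\in E$ iff $i=j$, and (IM2) $\{u_1,\dots,u_k\}$ is an independent set in $G$. -}

module Defs where

open import Data.Nat using (ℕ; zero; suc; _+_)
open import Data.Bool using (Bool; true; false; _∧_; T?)
open import Data.Fin using (Fin; _<_)
open import Data.Fin.Subset using (Subset; _∈_; Nonempty)
open import Data.Vec using (lookup)
open import Data.List using (List; length; filter; allFin; concatMap; map)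
open import Data.Product using (_×_; _,_; proj₁; proj₂)
open import Data.Sum using (_⊎_)
open import Relation.Binary.PropositionalEquality using (_≡_; _≢_)
open import Relation.Nullary using (¬_)
open import Data.Fin using (_<?_)
open import Relation.Nullary.Decidable using (⌊_⌋)

record Graph : Set where
  field
    n     : ℕ
    adj   : Fin (suc n) → Fin (suc n) → Bool
    sym   : ∀ x y → adj x y ≡ adj y x
    irrefl : ∀ x → adj x x ≡ false

open Graph public

V : Graph → Set
V G = Fin (suc (n G))

Adj : (G : Graph) → V G → V G → Set
Adj G x y = adj G x y ≡ true

allPairs : (m : ℕ) → List (Fin m × Fin m)
allPairs m = concatMap (λ x → map (x ,_) (allFin m)) (allFin m)

edgeCount : (G : Graph) → Subset (suc (n G)) → ℕ
edgeCount G S =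
  length (filter (λ p → T? (⌊ proj₁ p <? proj₂ p ⌋ ∧ lookup S (proj₁ p) ∧ lookup S (proj₂ p)
                             ∧ adj G (proj₁ p) (proj₂ p)))
                 (allPairs (suc (n G))))

HasKEdgeInducedSubgraph : ℕ → Graph → Set
HasKEdgeInducedSubgraph k G =
  Data.Product.Σ (Subset (suc (n G))) (λ S → Nonempty S × edgeCount G S ≡ k)

record IMStructure (k : ℕ) (G : Graph) : Set where
  field
    u v : Fin k → V G
    u-inj : ∀ i j → u i ≡ u j → i ≡ j
    v-inj : ∀ i j → v i ≡ v j → i ≡ j
    uv-distinct : ∀ i j → u i ≢ v j
    im1 : ∀ i j → (Adj G (u i) (v j) → i ≡ j) × (i ≡ j → Adj G (u i) (v j))
    im2 : ∀ i j → ¬ Adj G (u i) (u j)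

module Submission where

-- Write e(S) for the number of edges of G[S] and V = {v₀, …, v_{k-1}}. For m ≤ k, adding
-- u₀, …, u_{m-1} to V adds exactly m edges, since uᵢ is adjacent to vᵢ and to no other vertex of
-- the set; so every t with e(V) ≤ t ≤ e(V) + k is realised. Removing v₀ loses at most k - 1 edges
-- and leaves a matching structure of size k - 1, so by induction every t ≤ e(V) + k is realised,
-- in particular t = k. Edge counts are handled through the weighted count
-- Σ_{x<y} μ(x) μ(y) [xy ∈ E] of a vertex multiset μ, which is additive in μ up to the cross term
-- Σ_{x,y} μ(x) ν(y) [xy ∈ E].

open import Defs hiding (sym)

open import Data.Bool using (Bool; true; false; _∧_; T?)
open import Data.Fin using (Fin; zero; suc; _<?_)
open import Data.Fin.Properties using (_≟_; <-cmp; <-asym; suc-injective)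
open import Data.List using (List; []; _∷_; _++_; length; map; filter; concatMap; tabulate; allFin; take)
open import Data.List.Properties using (map-++; map-tabulate; map-∘; length-take; length-tabulate)
open import Data.List.Membership.Propositional using (_∈_; _∉_)
open import Data.List.Membership.Propositional.Properties using (∈-map⁻; ∈-tabulate⁻)
open import Data.List.Relation.Unary.All using ([])
open import Data.List.Relation.Unary.Any using (here; there)
open import Data.List.Relation.Unary.Unique.Propositional using (Unique; []; _∷_)
open import Data.List.Relation.Unary.Unique.Propositional.Properties
  using (Unique[x∷xs]⇒x∉xs; map⁺; tabulate⁺; take⁺; allFin⁺; ++⁺)
open import Data.Nat using (ℕ; zero; suc; _+_; _*_; _∸_; _≤_; _≤?_; _⊓_; z≤n; s≤s)
open import Data.Nat.ListAction using (sum)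
open import Data.Nat.ListAction.Properties using (sum-++)
open import Data.Nat.Properties
  using (+-*-semiring; +-mono-≤; +-monoʳ-≤; ≤-trans; ≤-reflexive; <⇒≤; ≰⇒>; m≤n+m; m+[n∸m]≡n;
         m≤n+o⇒m∸n≤o; m≤n⇒m⊓n≡m; +-identityʳ; +-assoc; +-comm; *-identityʳ; *-zeroʳ; *-comm; *-assoc;
         *-distribʳ-+; *-distribˡ-+)
open import Algebra.Properties.Semiring.Sum +-*-semiring
  using (sum-syntax; ∑-comm; ∑-distrib-+; *-distribˡ-sum; sum-cong-≗; sum-replicate-zero)
open import Data.Nat.Tactic.RingSolver using (solve-∀)
open import Data.Product using (_×_; _,_; proj₁; proj₂)
open import Data.Vec using (lookup)
open import Data.Vec.Properties using (lookup∘tabulate; lookup⇒[]=)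
import Data.Vec as Vec
open import Function using (_∘_)
open import Relation.Binary using (tri<; tri≈; tri>)
open import Relation.Binary.PropositionalEquality
open import Relation.Nullary using (does; yes; no; ¬_; contradiction)
open import Relation.Nullary.Decidable using (⌊_⌋; dec-true; dec-false)

𝟙 : Bool → ℕ
𝟙 false = 0
𝟙 true  = 1

𝟙-∧ : ∀ a b → 𝟙 (a ∧ b) ≡ 𝟙 a * 𝟙 b
𝟙-∧ false b = refl
𝟙-∧ true  b = sym (+-identityʳ (𝟙 b))

𝟙≤1 : ∀ b → 𝟙 b ≤ 1
𝟙≤1 false = z≤n
𝟙≤1 true  = s≤s z≤n

𝟙-≢true : ∀ {b} → b ≢ true → 𝟙 b ≡ 0
𝟙-≢true {false} _   = refl
𝟙-≢true {true}  b≢t = contradiction refl b≢t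

module _ {A : Set} where

  length-filter-T? : (b : A → Bool) (xs : List A) →
                     length (filter (T? ∘ b) xs) ≡ sum (map (𝟙 ∘ b) xs)
  length-filter-T? b []       = refl
  length-filter-T? b (x ∷ xs) with b x
  ... | true  = cong suc (length-filter-T? b xs)
  ... | false = length-filter-T? b xs

  sum-map-𝟙≤length : (b : A → Bool) (xs : List A) → sum (map (𝟙 ∘ b) xs) ≤ length xs
  sum-map-𝟙≤length b []       = z≤n
  sum-map-𝟙≤length b (x ∷ xs) = +-mono-≤ (𝟙≤1 (b x)) (sum-map-𝟙≤length b xs)

  sum-map-concatMap : {B : Set} (g : B → ℕ) (f : A → List B) (xs : List A) →
                      sum (map g (concatMap f xs)) ≡ sum (map (sum ∘ map g ∘ f) xs)
  sum-map-concatMap g f []       = refl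
  sum-map-concatMap g f (x ∷ xs) = begin
    sum (map g (f x ++ concatMap f xs))                  ≡⟨ cong sum (map-++ g (f x) _) ⟩
    sum (map g (f x) ++ map g (concatMap f xs))          ≡⟨ sum-++ (map g (f x)) _ ⟩
    sum (map g (f x)) + sum (map g (concatMap f xs))
      ≡⟨ cong (sum (map g (f x)) +_) (sum-map-concatMap g f xs) ⟩
    sum (map g (f x)) + sum (map (sum ∘ map g ∘ f) xs)   ∎
    where open ≡-Reasoning

sum-tabulate : ∀ {m} (f : Fin m → ℕ) → sum (tabulate f) ≡ ∑[ i < m ] f i
sum-tabulate {zero}  f = refl
sum-tabulate {suc m} f = cong (f zero +_) (sum-tabulate (f ∘ suc))

sum-map-allFin : ∀ {m} (f : Fin m → ℕ) → sum (map f (allFin m)) ≡ ∑[ i < m ] f i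
sum-map-allFin f = trans (cong sum (map-tabulate (λ i → i) f)) (sum-tabulate f)

δ : ∀ {m} → Fin m → Fin m → ℕ
δ w x = 𝟙 (does (w ≟ x))

δ-refl : ∀ {m} (x : Fin m) → δ x x ≡ 1
δ-refl x = cong 𝟙 (dec-true (x ≟ x) refl)

δ-≢ : ∀ {m} {w x : Fin m} → w ≢ x → δ w x ≡ 0
δ-≢ {w = w} {x} w≢x = cong 𝟙 (dec-false (w ≟ x) w≢x)

∑-δ : ∀ {m} (w : Fin m) (f : Fin m → ℕ) → ∑[ x < m ] (δ w x * f x) ≡ f w
∑-δ {suc m} zero    f =
  trans (cong₂ _+_ (+-identityʳ (f zero)) (sum-replicate-zero m)) (+-identityʳ (f zero))
∑-δ {suc m} (suc w) f = ∑-δ w (f ∘ suc)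

module _ {m : ℕ} where

  multiplicity : List (Fin m) → Fin m → ℕ
  multiplicity []      x = 0
  multiplicity (y ∷ L) x = δ y x + multiplicity L x

  ∑-multiplicity : (L : List (Fin m)) (f : Fin m → ℕ) →
                   ∑[ x < m ] (multiplicity L x * f x) ≡ sum (map f L)
  ∑-multiplicity []      f = sum-replicate-zero m
  ∑-multiplicity (y ∷ L) f = begin
    ∑[ x < m ] ((δ y x + multiplicity L x) * f x)
      ≡⟨ sum-cong-≗ (λ x → *-distribʳ-+ (f x) (δ y x) (multiplicity L x)) ⟩
    ∑[ x < m ] (δ y x * f x + multiplicity L x * f x)
      ≡⟨ ∑-distrib-+ (λ x → δ y x * f x) (λ x → multiplicity L x * f x) ⟩
    ∑[ x < m ] (δ y x * f x) + ∑[ x < m ] (multiplicity L x * f x)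
      ≡⟨ cong₂ _+_ (∑-δ y f) (∑-multiplicity L f) ⟩
    f y + sum (map f L)
      ∎
    where open ≡-Reasoning

  multiplicity-∉ : ∀ {x} {L : List (Fin m)} → x ∉ L → multiplicity L x ≡ 0
  multiplicity-∉ {L = []}    _   = refl
  multiplicity-∉ {L = y ∷ L} x∉L =
    cong₂ _+_ (δ-≢ (λ y≡x → x∉L (here (sym y≡x)))) (multiplicity-∉ (x∉L ∘ there))

  multiplicity-∈ : ∀ {x} {L : List (Fin m)} → Unique L → x ∈ L → multiplicity L x ≡ 1
  multiplicity-∈ {x} uL (here refl) =
    cong₂ _+_ (δ-refl x) (multiplicity-∉ (Unique[x∷xs]⇒x∉xs uL))
  multiplicity-∈ {x} {y ∷ _} uL@(_ ∷ uL′) (there x∈L′) =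
    cong₂ _+_ (δ-≢ {w = y} {x} (λ { refl → Unique[x∷xs]⇒x∉xs uL x∈L′ })) (multiplicity-∈ uL′ x∈L′)

module _ {m : ℕ} where

  open import Data.List.Membership.DecPropositional (_≟_ {m}) using (_∈?_)

  ⟦_⟧ : List (Fin m) → Fin m → Bool
  ⟦ L ⟧ x = does (x ∈? L)

  𝟙⟦⟧≗multiplicity : ∀ {L} → Unique L → ∀ x → 𝟙 (⟦ L ⟧ x) ≡ multiplicity L x
  𝟙⟦⟧≗multiplicity {L} uL x with x ∈? L
  ... | yes x∈L = sym (multiplicity-∈ uL x∈L)
  ... | no  x∉L = sym (multiplicity-∉ x∉L)

  ⟦⟧-∈ : ∀ {x L} → x ∈ L → ⟦ L ⟧ x ≡ true
  ⟦⟧-∈ {x} {L} = dec-true (x ∈? L)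

∑∑ : ∀ {m n} → (Fin m → Fin n → ℕ) → ℕ
∑∑ {m} {n} f = ∑[ x < m ] ∑[ y < n ] f x y

∑∑-cong : ∀ {m n} {f g : Fin m → Fin n → ℕ} → (∀ x y → f x y ≡ g x y) → ∑∑ f ≡ ∑∑ g
∑∑-cong f≡g = sum-cong-≗ (λ x → sum-cong-≗ (f≡g x))

∑∑-distrib-+ : ∀ {m n} (f g : Fin m → Fin n → ℕ) → ∑∑ (λ x y → f x y + g x y) ≡ ∑∑ f + ∑∑ g
∑∑-distrib-+ {n = n} f g =
  trans (sum-cong-≗ (λ x → ∑-distrib-+ (f x) (g x)))
        (∑-distrib-+ (λ x → ∑[ y < n ] f x y) (λ x → ∑[ y < n ] g x y))

∑∑-zero : ∀ m n → ∑∑ {m} {n} (λ _ _ → 0) ≡ 0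
∑∑-zero m n =
  trans (sum-cong-≗ {m} {λ _ → ∑[ y < n ] 0} (λ _ → sum-replicate-zero n)) (sum-replicate-zero m)

length-filter-allPairs : ∀ {m} (b : Fin m × Fin m → Bool) →
                         length (filter (T? ∘ b) (allPairs m)) ≡ ∑∑ (λ x y → 𝟙 (b (x , y)))
length-filter-allPairs {m} b = begin
  length (filter (T? ∘ b) (allPairs m))
    ≡⟨ length-filter-T? b (allPairs m) ⟩
  sum (map (𝟙 ∘ b) (allPairs m))
    ≡⟨ sum-map-concatMap (𝟙 ∘ b) row (allFin m) ⟩
  sum (map (sum ∘ map (𝟙 ∘ b) ∘ row) (allFin m))
    ≡⟨ sum-map-allFin (sum ∘ map (𝟙 ∘ b) ∘ row) ⟩
  ∑[ x < m ] sum (map (𝟙 ∘ b) (row x))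
    ≡⟨ sum-cong-≗ (λ x → cong sum (map-∘ {g = 𝟙 ∘ b} {f = x ,_} (allFin m))) ⟨
  ∑[ x < m ] sum (map (λ y → 𝟙 (b (x , y))) (allFin m))
    ≡⟨ sum-cong-≗ (λ x → sum-map-allFin (λ y → 𝟙 (b (x , y)))) ⟩
  ∑[ x < m ] ∑[ y < m ] 𝟙 (b (x , y))
    ∎
  where
  open ≡-Reasoning
  row : Fin m → List (Fin m × Fin m)
  row x = map (x ,_) (allFin m)

𝟙<?+𝟙>? : ∀ {m} {x y : Fin m} → x ≢ y → 𝟙 ⌊ x <? y ⌋ + 𝟙 ⌊ y <? x ⌋ ≡ 1
𝟙<?+𝟙>? {x = x} {y} x≢y with x <? y | y <? x
... | yes x<y | yes y<x = contradiction y<x (<-asym x<y)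
... | yes _   | no _    = refl
... | no _    | yes _   = refl
... | no x≮y  | no y≮x with <-cmp x y
...   | tri< x<y _ _ = contradiction x<y x≮y
...   | tri≈ _ x≡y _ = contradiction x≡y x≢y
...   | tri> _ _ y<x = contradiction y<x y≮x

module _ (G : Graph) where

  private
    N : ℕ
    N = suc (n G)

  adjℕ : V G → V G → ℕ
  adjℕ x y = 𝟙 (adj G x y)

  adj< : V G → V G → ℕ
  adj< x y = 𝟙 ⌊ x <? y ⌋ * adjℕ x y

  adj<+adj> : ∀ x y → adj< x y + adj< y x ≡ adjℕ x y
  adj<+adj> x y with x ≟ y
  ... | yes refl rewrite irrefl G x | *-zeroʳ (𝟙 ⌊ x <? x ⌋) = refl
  ... | no x≢y   rewrite Graph.sym G y x =
    trans (sym (*-distribʳ-+ (adjℕ x y) (𝟙 ⌊ x <? y ⌋) _))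
          (trans (cong (_* adjℕ x y) (𝟙<?+𝟙>? x≢y)) (+-identityʳ (adjℕ x y)))

  edgeWeight : (V G → ℕ) → ℕ
  edgeWeight μ = ∑∑ (λ x y → μ x * μ y * adj< x y)

  crossWeight : (V G → ℕ) → (V G → ℕ) → ℕ
  crossWeight μ ν = ∑∑ (λ x y → μ x * ν y * adjℕ x y)

  edgeCount-tabulate : (s : V G → Bool) → edgeCount G (Vec.tabulate s) ≡ edgeWeight (𝟙 ∘ s)
  edgeCount-tabulate s = trans (length-filter-allPairs inducedEdge) (∑∑-cong summand)
    where
    S = Vec.tabulate s
    inducedEdge : V G × V G → Bool
    inducedEdge (x , y) = ⌊ x <? y ⌋ ∧ lookup S x ∧ lookup S y ∧ adj G x y
    rearrange : ∀ l a b c → l * (a * (b * c)) ≡ a * b * (l * c)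
    rearrange = solve-∀
    summand : ∀ x y → 𝟙 (inducedEdge (x , y)) ≡ 𝟙 (s x) * 𝟙 (s y) * adj< x y
    summand x y rewrite lookup∘tabulate s x | lookup∘tabulate s y | 𝟙-∧ ⌊ x <? y ⌋ (s x ∧ s y ∧ adj G x y)
                      | 𝟙-∧ (s x) (s y ∧ adj G x y) | 𝟙-∧ (s y) (adj G x y)
      = rearrange (𝟙 ⌊ x <? y ⌋) (𝟙 (s x)) (𝟙 (s y)) (adjℕ x y)

  edgeWeight-cong : ∀ {μ ν} → (∀ x → μ x ≡ ν x) → edgeWeight μ ≡ edgeWeight ν
  edgeWeight-cong μ≗ν = ∑∑-cong (λ x y → cong₂ (λ a b → a * b * adj< x y) (μ≗ν x) (μ≗ν y))

  edgeWeight-+ : ∀ μ ν →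
                 edgeWeight (λ x → μ x + ν x) ≡ edgeWeight μ + edgeWeight ν + crossWeight μ ν
  edgeWeight-+ μ ν = begin
    ∑∑ (λ x y → (μ x + ν x) * (μ y + ν y) * adj< x y)
      ≡⟨ ∑∑-cong (λ x y → expand (μ x) (ν x) (μ y) (ν y) (adj< x y)) ⟩
    ∑∑ (λ x y → (w μ μ x y + w ν ν x y) + (w μ ν x y + w ν μ x y))
      ≡⟨ ∑∑-distrib-+ (λ x y → w μ μ x y + w ν ν x y) (λ x y → w μ ν x y + w ν μ x y) ⟩
    ∑∑ (λ x y → w μ μ x y + w ν ν x y) + ∑∑ (λ x y → w μ ν x y + w ν μ x y)
      ≡⟨ cong₂ _+_ (∑∑-distrib-+ (w μ μ) (w ν ν)) cross ⟩
    edgeWeight μ + edgeWeight ν + crossWeight μ ν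
      ∎
    where
    open ≡-Reasoning
    w : (V G → ℕ) → (V G → ℕ) → V G → V G → ℕ
    w α β x y = α x * β y * adj< x y
    expand : ∀ a b c d e → (a + b) * (c + d) * e ≡ (a * c * e + b * d * e) + (a * d * e + b * c * e)
    expand = solve-∀
    -- Swapping the summation order turns the y < x half of each edge into the x < y half.
    cross : ∑∑ (λ x y → w μ ν x y + w ν μ x y) ≡ crossWeight μ ν
    cross = begin
      ∑∑ (λ x y → w μ ν x y + w ν μ x y)
        ≡⟨ ∑∑-distrib-+ (w μ ν) (w ν μ) ⟩
      ∑∑ (w μ ν) + ∑∑ (w ν μ)
        ≡⟨ cong (∑∑ (w μ ν) +_) (∑-comm (w ν μ)) ⟩
      ∑∑ (w μ ν) + ∑∑ (λ x y → ν y * μ x * adj< y x)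
        ≡⟨ cong (∑∑ (w μ ν) +_) (∑∑-cong (λ x y → cong (_* adj< y x) (*-comm (ν y) (μ x)))) ⟩
      ∑∑ (w μ ν) + ∑∑ (λ x y → μ x * ν y * adj< y x)
        ≡⟨ ∑∑-distrib-+ (w μ ν) (λ x y → μ x * ν y * adj< y x) ⟨
      ∑∑ (λ x y → μ x * ν y * adj< x y + μ x * ν y * adj< y x)
        ≡⟨ ∑∑-cong (λ x y → trans (sym (*-distribˡ-+ (μ x * ν y) (adj< x y) (adj< y x)))
                                   (cong (μ x * ν y *_) (adj<+adj> x y))) ⟩
      crossWeight μ ν
        ∎

  edgeWeight-δ : ∀ w → edgeWeight (δ w) ≡ 0
  edgeWeight-δ w = trans (∑∑-cong δδ) (∑∑-zero N N)
    where
    δδ : ∀ x y → δ w x * δ w y * adj< x y ≡ 0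
    δδ x y with w ≟ x | w ≟ y
    ... | yes refl | yes refl rewrite irrefl G w | *-zeroʳ (𝟙 ⌊ w <? w ⌋) = refl
    ... | yes _    | no _     = refl
    ... | no _     | _        = refl

  crossWeight-δ : ∀ w ν → crossWeight (δ w) ν ≡ ∑[ y < N ] (ν y * adjℕ w y)
  crossWeight-δ w ν = begin
    ∑∑ (λ x y → δ w x * ν y * adjℕ x y)
      ≡⟨ sum-cong-≗ (λ x → sum-cong-≗ (λ y → *-assoc (δ w x) (ν y) (adjℕ x y))) ⟩
    ∑[ x < N ] ∑[ y < N ] (δ w x * (ν y * adjℕ x y))
      ≡⟨ sum-cong-≗ (λ x → *-distribˡ-sum (δ w x) (λ y → ν y * adjℕ x y)) ⟨
    ∑[ x < N ] (δ w x * ∑[ y < N ] (ν y * adjℕ x y))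
      ≡⟨ ∑-δ w (λ x → ∑[ y < N ] (ν y * adjℕ x y)) ⟩
    ∑[ y < N ] (ν y * adjℕ w y)
      ∎
    where open ≡-Reasoning

  degreeIn : V G → List (V G) → ℕ
  degreeIn x L = sum (map (adjℕ x) L)

  edgesOf : List (V G) → ℕ
  edgesOf []      = 0
  edgesOf (y ∷ L) = edgesOf L + degreeIn y L

  degreeIn-++ : ∀ x L L′ → degreeIn x (L ++ L′) ≡ degreeIn x L + degreeIn x L′
  degreeIn-++ x L L′ = trans (cong sum (map-++ (adjℕ x) L L′)) (sum-++ (map (adjℕ x) L) _)

  edgeWeight-multiplicity : ∀ L → edgeWeight (multiplicity L) ≡ edgesOf L
  edgeWeight-multiplicity []      = ∑∑-zero N N
  edgeWeight-multiplicity (y ∷ L) = begin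
    edgeWeight (multiplicity (y ∷ L))
      ≡⟨ edgeWeight-+ (δ y) (multiplicity L) ⟩
    edgeWeight (δ y) + edgeWeight (multiplicity L) + crossWeight (δ y) (multiplicity L)
      ≡⟨ cong₂ _+_ (cong₂ _+_ (edgeWeight-δ y) (edgeWeight-multiplicity L))
                   (crossWeight-δ y (multiplicity L)) ⟩
    edgesOf L + ∑[ z < N ] (multiplicity L z * adjℕ y z)
      ≡⟨ cong (edgesOf L +_) (∑-multiplicity L (adjℕ y)) ⟩
    edgesOf L + degreeIn y L
      ∎
    where open ≡-Reasoning

  edgeCount-⟦⟧ : ∀ {L} → Unique L → edgeCount G (Vec.tabulate ⟦ L ⟧) ≡ edgesOf L
  edgeCount-⟦⟧ {L} uL = begin
    edgeCount G (Vec.tabulate ⟦ L ⟧)    ≡⟨ edgeCount-tabulate ⟦ L ⟧ ⟩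
    edgeWeight (𝟙 ∘ ⟦ L ⟧)              ≡⟨ edgeWeight-cong (𝟙⟦⟧≗multiplicity uL) ⟩
    edgeWeight (multiplicity L)         ≡⟨ edgeWeight-multiplicity L ⟩
    edgesOf L                           ∎
    where open ≡-Reasoning

  inducedSubgraph-∈ : ∀ {y L} → Unique L → y ∈ L → HasKEdgeInducedSubgraph (edgesOf L) G
  inducedSubgraph-∈ {y} {L} uL y∈L =
    Vec.tabulate ⟦ L ⟧ ,
    (y , lookup⇒[]= y _ (trans (lookup∘tabulate ⟦ L ⟧ y) (⟦⟧-∈ y∈L))) ,
    edgeCount-⟦⟧ uL

  -- The empty vertex set is not allowed, so an edgeless set is realised by a single vertex.
  inducedSubgraph : ∀ {L} → Unique L → HasKEdgeInducedSubgraph (edgesOf L) G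
  inducedSubgraph {[]}    _  = inducedSubgraph-∈ {zero} {zero ∷ []} ([] ∷ []) (here refl)
  inducedSubgraph {y ∷ L} uL = inducedSubgraph-∈ uL (here refl)

module _ {G : Graph} where

  tailIM : ∀ {k} → IMStructure (suc k) G → IMStructure k G
  tailIM M = record
    { u           = u ∘ suc
    ; v           = v ∘ suc
    ; u-inj       = λ i j → suc-injective ∘ u-inj (suc i) (suc j)
    ; v-inj       = λ i j → suc-injective ∘ v-inj (suc i) (suc j)
    ; uv-distinct = λ i j → uv-distinct (suc i) (suc j)
    ; im1         = λ i j → suc-injective ∘ proj₁ (im1 (suc i) (suc j))
                          , proj₂ (im1 (suc i) (suc j)) ∘ cong suc
    ; im2         = λ i j → im2 (suc i) (suc j)
    }
    where open IMStructure M

  edgesAmongVs : ∀ {k} → IMStructure k G → ℕ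
  edgesAmongVs M = edgesOf G (tabulate (IMStructure.v M))

  module _ {k} (M : IMStructure k G) where

    open IMStructure M

    matched : List (Fin k) → List (V G)
    matched I = map u I ++ tabulate v

    adjℕ-u-v : ∀ i l → adjℕ G (u i) (v l) ≡ δ i l
    adjℕ-u-v i l with i ≟ l
    ... | yes refl = cong 𝟙 (proj₂ (im1 i i) refl)
    ... | no  i≢l  = 𝟙-≢true (i≢l ∘ proj₁ (im1 i l))

    degreeIn-u-us : ∀ i I → degreeIn G (u i) (map u I) ≡ 0
    degreeIn-u-us i []       = refl
    degreeIn-u-us i (i′ ∷ I) = cong₂ _+_ (𝟙-≢true (im2 i i′)) (degreeIn-u-us i I)

    degreeIn-u-vs : ∀ i → degreeIn G (u i) (tabulate v) ≡ 1
    degreeIn-u-vs i = begin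
      sum (map (adjℕ G (u i)) (tabulate v))    ≡⟨ cong sum (map-tabulate v (adjℕ G (u i))) ⟩
      sum (tabulate (adjℕ G (u i) ∘ v))        ≡⟨ sum-tabulate (adjℕ G (u i) ∘ v) ⟩
      ∑[ l < k ] adjℕ G (u i) (v l)
        ≡⟨ sum-cong-≗ (λ l → trans (adjℕ-u-v i l) (sym (*-identityʳ (δ i l)))) ⟩
      ∑[ l < k ] (δ i l * 1)                   ≡⟨ ∑-δ i (λ _ → 1) ⟩
      1                                        ∎
      where open ≡-Reasoning

    edgesOf-matched : ∀ I → edgesOf G (matched I) ≡ edgesAmongVs M + length I
    edgesOf-matched []      = sym (+-identityʳ _)
    edgesOf-matched (i ∷ I) = begin
      edgesOf G (matched I) + degreeIn G (u i) (map u I ++ tabulate v)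
        ≡⟨ cong₂ _+_ (edgesOf-matched I) (degreeIn-++ G (u i) (map u I) (tabulate v)) ⟩
      edgesAmongVs M + length I + (degreeIn G (u i) (map u I) + degreeIn G (u i) (tabulate v))
        ≡⟨ cong (edgesAmongVs M + length I +_) (cong₂ _+_ (degreeIn-u-us i I) (degreeIn-u-vs i)) ⟩
      edgesAmongVs M + length I + 1
        ≡⟨ +-assoc (edgesAmongVs M) (length I) 1 ⟩
      edgesAmongVs M + (length I + 1)
        ≡⟨ cong (edgesAmongVs M +_) (+-comm (length I) 1) ⟩
      edgesAmongVs M + suc (length I)
        ∎
      where open ≡-Reasoning

    matched-unique : ∀ {I} → Unique I → Unique (matched I)
    matched-unique {I} uI = ++⁺ (map⁺ (u-inj _ _) uI) (tabulate⁺ (v-inj _ _)) disjoint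
      where
      disjoint : ∀ {x} → ¬ (x ∈ map u I × x ∈ tabulate v)
      disjoint (x∈us , x∈vs) with ∈-map⁻ u x∈us | ∈-tabulate⁻ x∈vs
      ... | i , _ , refl | l , ui≡vl = uv-distinct i l ui≡vl

    realise-above : ∀ m → m ≤ k → HasKEdgeInducedSubgraph (edgesAmongVs M + m) G
    realise-above m m≤k =
      subst (λ t → HasKEdgeInducedSubgraph t G) (trans (edgesOf-matched I) (cong (_ +_) |I|≡m))
            (inducedSubgraph G (matched-unique (take⁺ m (allFin⁺ k))))
      where
      I = take m (allFin k)
      |I|≡m : length I ≡ m
      |I|≡m = trans (length-take m (allFin k))
                    (trans (cong (m ⊓_) (length-tabulate (λ i → i))) (m≤n⇒m⊓n≡m m≤k))

  realise : ∀ {k} (M : IMStructure k G) t → t ≤ edgesAmongVs M + k → HasKEdgeInducedSubgraph t G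
  realise M t t≤e+k with edgesAmongVs M ≤? t
  ... | yes e≤t = subst (λ s → HasKEdgeInducedSubgraph s G) (m+[n∸m]≡n e≤t)
                        (realise-above M (t ∸ e) (m≤n+o⇒m∸n≤o t e t≤e+k))
    where e = edgesAmongVs M
  realise {zero}  M t _ | no e≰t = contradiction z≤n e≰t
  realise {suc k} M t _ | no e≰t =
    realise (tailIM M) t (≤-trans (<⇒≤ (≰⇒> e≰t)) (+-monoʳ-≤ (edgesAmongVs (tailIM M)) deg≤k))
    where
    open IMStructure M
    deg≤k : degreeIn G (v zero) (tabulate (v ∘ suc)) ≤ k
    deg≤k = ≤-trans (sum-map-𝟙≤length (adj G (v zero)) (tabulate (v ∘ suc)))
                    (≤-reflexive (length-tabulate (v ∘ suc)))

lemma3p2 : (k : ℕ) (G : Graph) → IMStructure k G → HasKEdgeInducedSubgraph k G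
lemma3p2 k G M = realise M k (m≤n+m k _)
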